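{- Let $q$ be a power of an odd prime with $3\nmid q-1$, let $\lambda\in\mathbb{F}_q$ be a non-square, and let $a\in\mathbb{F}_q^*$. Then the graph $\mathcal{G}(\lambda,X^3+a)$ has no (weakly) connected component with exactly four vertices.
   Context: For a polynomial $f\in\mathbb{F}_q[X]$ and a non-square $\lambda\in\mathbb{F}_q$, $\mathcal{G}(\lambda,f)$ is the directed graph with vertex set $\mathbb{F}_q$ and an edge from $x$ to $y$ iff $(y^2-f(x))(\lambda y^2-f(x))=0$ (loops allowed). -}

module Defs where

open import Level using (0ℓ)
open import Data.Nat using (ℕ)
open import Data.Fin using (Fin)
open import Data.Product using (Σ; ∃; _×_; _,_)
open import Data.Sum using (_⊎_)
open import Relation.Nullary using (¬_)
open import Relation.Binary.PropositionalEquality as ≡ using (_≡_)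
open import Relation.Binary.Construct.Closure.ReflexiveTransitive using (Star)
open import Algebra.Bundles using (CommutativeRing)
open import Function.Bundles using (Bijection)

record FiniteField (q : ℕ) : Set₁ where
  field
    commRing : CommutativeRing 0ℓ 0ℓ
  open CommutativeRing commRing public
  field
    0≉1     : ¬ (0# ≈ 1#)
    inverse : ∀ x → ¬ (x ≈ 0#) → ∃ λ y → x * y ≈ 1#
    enum    : Bijection (≡.setoid (Fin q)) setoid

module Graph {q : ℕ} (F : FiniteField q) where
  open FiniteField F

  IsSquare : Carrier → Set
  IsSquare x = ∃ λ y → y * y ≈ x

  Edge : Carrier → (Carrier → Carrier) → Carrier → Carrier → Set
  Edge lam f x y = ((y * y - f x) * (lam * (y * y) - f x)) ≈ 0#

  -- underlying undirected adjacency (plus setoid equality, so that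
  -- connectivity respects _≈_)
  Adj : Carrier → (Carrier → Carrier) → Carrier → Carrier → Set
  Adj lam f x y = Edge lam f x y ⊎ Edge lam f y x ⊎ x ≈ y

  Conn : Carrier → (Carrier → Carrier) → Carrier → Carrier → Set
  Conn lam f = Star (Adj lam f)

  ComponentOfSize : Carrier → (Carrier → Carrier) → Carrier → ℕ → Set
  ComponentOfSize lam f x n =
    Σ (Fin n → Carrier) λ v →
      (∀ i j → v i ≈ v j → i ≡ j) ×
      (∀ y → (Conn lam f x y → ∃ λ i → y ≈ v i) × ((∃ λ i → y ≈ v i) → Conn lam f x y))

  HasComponentOfSize : Carrier → (Carrier → Carrier) → ℕ → Set
  HasComponentOfSize lam f n = ∃ λ x → ComponentOfSize lam f x n

  cubePlus : Carrier → Carrier → Carrier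
  cubePlus a x = x * x * x + a

-- Since 3 ∤ q − 1, cubing is a bijection of F_q, so every element is a value
-- f(t) = t³ + a; since q is odd, 2 ≠ 0. A component containing w contains the
-- preimage t of w² (edge t → w) and so also −w (edge t → −w). Hence a
-- component C with four vertices is closed under negation; it misses 0, as
-- negation would otherwise pair off its three nonzero vertices, so
-- C = {±u, ±w} with u² ≠ w². The preimages of the four distinct values
-- u², λu², w², λw² lie in C and therefore exhaust it, so negation pairs them,
-- and f(t) + f(−t) = 2a turns this into a pairing of the four values with
-- sums 2a. Each of the three possible pairings forces λ = 1, u² = w² or a = 0.

module Submission where

open import Defs
open import Data.Nat using (ℕ; suc; _^_; _∸_)
open import Data.Nat.Divisibility using (_∣_)
open import Data.Nat.Primality using (Prime)
open import Relation.Nullary using (¬_)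
open import Relation.Binary.PropositionalEquality using (_≡_)

open import Data.Nat.Base using (zero; _<_; s≤s; z≤n; NonZero)
open import Data.Nat.Properties using (1+n≰n)
open import Data.Nat.Divisibility using (_∣?_)
open import Data.Nat.Primality using (euclidsLemma; prime[2]; prime⇒irreducible)
open import Data.Nat.GeneralisedArithmetic using (fold)
open import Data.Fin.Base using (Fin; punchOut)
open import Data.Fin.Patterns using (0F; 1F; 2F; 3F)
import Data.Fin.Properties as Fin
open import Data.List.Base using (List; []; _∷_; [_]; length; allFin)
open import Data.List.Properties using (length-tabulate)
open import Data.List.Membership.Propositional using (_∈_)
open import Data.List.Membership.Propositional.Properties using (∈-allFin)
open import Data.List.Relation.Unary.Any using (here)
open import Data.List.Relation.Unary.AllPairs using ([]; _∷_)
import Data.List.Relation.Unary.All as All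
open import Data.List.Relation.Unary.Unique.Propositional using (Unique)
open import Data.List.Relation.Unary.Unique.Propositional.Properties using (allFin⁺)
open import Data.Product.Base using (∃; _×_; _,_; proj₁; proj₂)
open import Data.Sum.Base using (_⊎_; inj₁; inj₂)
open import Data.Empty using (⊥)
open import Function.Bundles using (Bijection)
open import Relation.Binary.Construct.Closure.ReflexiveTransitive using (ε; _◅_; _◅◅_)
open import Relation.Binary.Definitions using (Decidable; DecidableEquality)
import Relation.Binary.PropositionalEquality as ≡
open ≡ using (_≢_)
open import Relation.Nullary using (yes; no; contradiction; map′)
open import Relation.Nullary.Decidable using (from-no)

injective⇒surjective : ∀ {n} (f : Fin n → Fin n) → (∀ {i j} → f i ≡ f j → i ≡ j) → ∀ j → ∃ λ i → f i ≡ j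
injective⇒surjective {zero} f f-inj ()
injective⇒surjective {suc n} f f-inj j with Fin.any? (λ i → f i Fin.≟ j)
... | yes hit = hit
... | no miss = contradiction (Fin.injective⇒≤ f-avoiding-j-injective) 1+n≰n
  where
  f≢j : ∀ i → j ≢ f i
  f≢j i eq = miss (i , ≡.sym eq)
  f-avoiding-j-injective : ∀ {i i′} → punchOut (f≢j i) ≡ punchOut (f≢j i′) → i ≡ i′
  f-avoiding-j-injective eq = f-inj (Fin.punchOut-injective (f≢j _) (f≢j _) eq)

module Counting {A : Set} (_≟_ : DecidableEquality A) where

  open import Data.Nat.Base using (pred; _+_; >-nonZero⁻¹)
  open import Data.Nat.Properties using (suc-pred; m<n⇒0<n∸m; m∸n≤m; m∸n+n≡m; ≤-<-trans; <⇒≤; ≤-reflexive; m<n+m)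
  open import Data.Nat.Induction using (<-wellFounded)
  open import Data.Nat.Divisibility using (_∣0; ∣-refl; ∣m∣n⇒∣m+n)
  open import Data.Nat.GeneralisedArithmetic using (fold-+)
  open import Data.List.Base using (filter; applyUpTo; _++_)
  open import Data.List.Properties using (length-++; length-applyUpTo)
  open import Data.List.Membership.Propositional using (_∉_)
  open import Data.List.Membership.Propositional.Properties using (∈-filter⁺; ∈-filter⁻; ∈-++⁺ˡ; ∈-++⁺ʳ; ∈-++⁻; ∈-applyUpTo⁺; ∈-applyUpTo⁻)
  open import Data.List.Membership.Propositional.Properties.WithK using (unique∧set⇒bag)
  open import Data.List.Membership.DecPropositional _≟_ using (_∈?_; _∉?_)
  open import Data.List.Relation.Unary.Unique.Propositional.Properties using (filter⁺; ++⁺; applyUpTo⁺₁)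
  open import Data.List.Relation.Binary.Subset.Propositional using (_⊆_)
  open import Data.List.Relation.Binary.BagAndSetEquality using (∼bag⇒↭)
  open import Data.List.Relation.Binary.Permutation.Propositional.Properties using (↭-length)
  open import Function.Bundles using (mk⇔)
  open import Induction.WellFounded using (Acc; acc)
  open ≡ using (refl; sym; trans; cong; subst; module ≡-Reasoning)

  infixl 6 _∖_
  _∖_ : List A → List A → List A
  xs ∖ ys = filter (_∉? ys) xs

  ∈-∖⁻ : ∀ xs ys {z} → z ∈ xs ∖ ys → z ∈ xs × z ∉ ys
  ∈-∖⁻ xs ys = ∈-filter⁻ (_∉? ys) {xs = xs}

  ∈-∖⁺ : ∀ ys {xs z} → z ∈ xs → z ∉ ys → z ∈ xs ∖ ys
  ∈-∖⁺ ys = ∈-filter⁺ (_∉? ys)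

  ∖-unique : ∀ {xs} ys → Unique xs → Unique (xs ∖ ys)
  ∖-unique ys = filter⁺ (_∉? ys)

  length-∖ : ∀ {xs ys} → Unique xs → Unique ys → ys ⊆ xs → length xs ≡ length ys + length (xs ∖ ys)
  length-∖ {xs} {ys} xs! ys! ys⊆xs = trans
    (↭-length (∼bag⇒↭ (unique∧set⇒bag xs! (++⁺ ys! (∖-unique ys xs!) disjoint) (mk⇔ split merge))))
    (length-++ ys)
    where
    disjoint : ∀ {z} → ¬ (z ∈ ys × z ∈ xs ∖ ys)
    disjoint (z∈ys , z∈rest) = proj₂ (∈-∖⁻ xs ys z∈rest) z∈ys
    split : ∀ {z} → z ∈ xs → z ∈ ys ++ xs ∖ ys
    split {z} z∈xs with z ∈? ys
    ... | yes z∈ys = ∈-++⁺ˡ z∈ys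
    ... | no z∉ys = ∈-++⁺ʳ ys (∈-∖⁺ ys z∈xs z∉ys)
    merge : ∀ {z} → z ∈ ys ++ xs ∖ ys → z ∈ xs
    merge z∈ with ∈-++⁻ ys z∈
    ... | inj₁ z∈ys  = ys⊆xs z∈ys
    ... | inj₂ z∈rest = proj₁ (∈-∖⁻ xs ys z∈rest)

  module FreeAction (f : A → A) (m : ℕ) .{{_ : NonZero m}} where

    f^ : ℕ → A → A
    f^ j x = fold x f j

    f^-suc : ∀ j x → f^ (suc j) x ≡ f^ j (f x)
    f^-suc zero x = refl
    f^-suc (suc j) x = cong f (f^-suc j x)

    orbit : A → List A
    orbit x = applyUpTo (λ j → f^ j x) m

    record FreeOn (xs : List A) : Set where
      field
        closed    : ∀ {x} → x ∈ xs → f x ∈ xs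
        periodic  : ∀ {x} → x ∈ xs → f^ m x ≡ x
        aperiodic : ∀ {x j} → x ∈ xs → 0 < j → j < m → f^ j x ≢ x

    pred<m : pred m < m
    pred<m = ≤-reflexive (suc-pred m)

    module _ {xs} (act : FreeOn xs) where
      open FreeOn act

      f^-closed : ∀ j {x} → x ∈ xs → f^ j x ∈ xs
      f^-closed zero x∈xs = x∈xs
      f^-closed (suc j) x∈xs = closed (f^-closed j x∈xs)

      f^pred∘f≗id : ∀ {x} → x ∈ xs → f^ (pred m) (f x) ≡ x
      f^pred∘f≗id {x} x∈xs = begin
        f^ (pred m) (f x)    ≡⟨ f^-suc (pred m) x ⟨
        f^ (suc (pred m)) x  ≡⟨ cong (λ k → f^ k x) (suc-pred m) ⟩
        f^ m x               ≡⟨ periodic x∈xs ⟩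
        x                    ∎
        where open ≡-Reasoning

      f-injective : ∀ {x y} → x ∈ xs → y ∈ xs → f x ≡ f y → x ≡ y
      f-injective x∈xs y∈xs eq =
        trans (sym (f^pred∘f≗id x∈xs)) (trans (cong (f^ (pred m)) eq) (f^pred∘f≗id y∈xs))

      orbit⊆ : ∀ {x} → x ∈ xs → orbit x ⊆ xs
      orbit⊆ x∈xs y∈orbit with j , _ , refl ← ∈-applyUpTo⁻ _ y∈orbit = f^-closed j x∈xs

      orbit-unique : ∀ {x} → x ∈ xs → Unique (orbit x)
      orbit-unique {x} x∈xs = applyUpTo⁺₁ _ m distinct
        where
        open ≡-Reasoning
        distinct : ∀ {i j} → i < j → j < m → f^ i x ≢ f^ j x
        distinct {i} {j} i<j j<m eq =
          aperiodic (f^-closed i x∈xs) (m<n⇒0<n∸m i<j) (≤-<-trans (m∸n≤m j i) j<m) (begin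
            f^ (j ∸ i) (f^ i x)  ≡⟨ fold-+ x f (j ∸ i) ⟨
            f^ (j ∸ i + i) x     ≡⟨ cong (λ k → f^ k x) (m∸n+n≡m (<⇒≤ i<j)) ⟩
            f^ j x               ≡⟨ eq ⟨
            f^ i x               ∎)

      preimage-in-orbit : ∀ {x y} → x ∈ xs → y ∈ xs → f y ∈ orbit x → y ∈ orbit x
      preimage-in-orbit {x} {y} x∈xs y∈xs fy∈orbit with ∈-applyUpTo⁻ _ fy∈orbit
      ... | zero , _ , fy≡x =
        subst (_∈ orbit x) (trans (cong (f^ (pred m)) (sym fy≡x)) (f^pred∘f≗id y∈xs)) (∈-applyUpTo⁺ _ pred<m)
      ... | suc j , j<m , fy≡fx′ =
        subst (_∈ orbit x) (f-injective (f^-closed j x∈xs) y∈xs (sym fy≡fx′)) (∈-applyUpTo⁺ _ (<⇒≤ j<m))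

      ∖-orbit : ∀ {x} → x ∈ xs → FreeOn (xs ∖ orbit x)
      ∖-orbit {x} x∈xs = record
        { closed    = λ y∈ → let y∈xs , y∉orbit = ∈-∖⁻ xs (orbit x) y∈ in
                      ∈-∖⁺ (orbit x) (closed y∈xs) (λ fy∈orbit → y∉orbit (preimage-in-orbit x∈xs y∈xs fy∈orbit))
        ; periodic  = λ y∈ → periodic (proj₁ (∈-∖⁻ xs (orbit x) y∈))
        ; aperiodic = λ y∈ → aperiodic (proj₁ (∈-∖⁻ xs (orbit x) y∈))
        }

    m∣length : ∀ {xs} → Unique xs → FreeOn xs → m ∣ length xs
    m∣length {xs} = go xs (<-wellFounded (length xs))
      where
      go : ∀ xs → Acc _<_ (length xs) → Unique xs → FreeOn xs → m ∣ length xs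
      go [] _ _ _ = m ∣0
      go xs@(x ∷ _) (acc smaller) xs! act =
        subst (m ∣_) (sym length-xs) (∣m∣n⇒∣m+n ∣-refl (go rest (smaller shorter) (∖-unique (orbit x) xs!) (∖-orbit act x∈xs)))
        where
        x∈xs : x ∈ xs
        x∈xs = here refl
        rest : List A
        rest = xs ∖ orbit x
        length-xs : length xs ≡ m + length rest
        length-xs = trans (length-∖ xs! (orbit-unique act x∈xs) (orbit⊆ act x∈xs)) (cong (_+ length rest) (length-applyUpTo _ m))
        shorter : length rest < length xs
        shorter = subst (length rest <_) (sym length-xs) (m<n+m (length rest) (>-nonZero⁻¹ m))

  2∣length-involution : (f : A → A) → (∀ x → f (f x) ≡ x) → ∀ {xs} → Unique xs →
    (∀ {x} → x ∈ xs → f x ∈ xs) → (∀ {x} → x ∈ xs → f x ≢ x) → 2 ∣ length xs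
  2∣length-involution f f∘f≗id {xs} xs! closed fixedPointFree =
    m∣length xs! (record { closed = closed ; periodic = λ {x} _ → f∘f≗id x ; aperiodic = aperiodic })
    where
    open FreeAction f 2
    aperiodic : ∀ {x j} → x ∈ xs → 0 < j → j < 2 → f^ j x ≢ x
    aperiodic {j = suc zero} x∈xs _ _ = fixedPointFree x∈xs
    aperiodic {j = suc (suc _)} _ _ (s≤s (s≤s ()))

involution-flip : ∀ {A : Set} (ρ : A → A) → (∀ k → ρ (ρ k) ≡ k) → ∀ {j k} → ρ j ≡ k → ρ k ≡ j
involution-flip ρ ρ∘ρ≗id {j} ρj≡k = ≡.trans (≡.cong ρ (≡.sym ρj≡k)) (ρ∘ρ≗id j)

module _ (ρ : Fin 4 → Fin 4) (ρ∘ρ≗id : ∀ k → ρ (ρ k) ≡ k) where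

  private
    flip : ∀ {j k} → ρ j ≡ k → ρ k ≡ j
    flip = involution-flip ρ ρ∘ρ≗id

  fixedPointFreeInvolution-Fin4 : (∀ k → ρ k ≢ k) →
    (ρ 0F ≡ 1F × ρ 2F ≡ 3F) ⊎ (ρ 0F ≡ 2F × ρ 1F ≡ 3F) ⊎ (ρ 0F ≡ 3F × ρ 1F ≡ 2F)
  fixedPointFreeInvolution-Fin4 ρk≢k with ρ 0F in ρ0 | ρ 1F in ρ1 | ρ 2F in ρ2
  ... | 0F | _  | _  = contradiction ρ0 (ρk≢k 0F)
  ... | 1F | _  | 3F = inj₁ (≡.refl , ≡.refl)
  ... | 1F | _  | 0F = contradiction (≡.trans (≡.sym ρ0) (flip ρ2)) λ ()
  ... | 1F | _  | 1F = contradiction (≡.trans (≡.sym (flip ρ0)) (flip ρ2)) λ ()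
  ... | 1F | _  | 2F = contradiction ρ2 (ρk≢k 2F)
  ... | 2F | 3F | _  = inj₂ (inj₁ (≡.refl , ≡.refl))
  ... | 2F | 0F | _  = contradiction (≡.trans (≡.sym ρ0) (flip ρ1)) λ ()
  ... | 2F | 1F | _  = contradiction ρ1 (ρk≢k 1F)
  ... | 2F | 2F | _  = contradiction (≡.trans (≡.sym (flip ρ0)) (flip ρ1)) λ ()
  ... | 3F | 2F | _  = inj₂ (inj₂ (≡.refl , ≡.refl))
  ... | 3F | 0F | _  = contradiction (≡.trans (≡.sym ρ0) (flip ρ1)) λ ()
  ... | 3F | 1F | _  = contradiction ρ1 (ρk≢k 1F)
  ... | 3F | 3F | _  = contradiction (≡.trans (≡.sym (flip ρ0)) (flip ρ1)) λ ()

¬2∣p^n : ∀ {p} → Prime p → p ≢ 2 → ∀ n → ¬ 2 ∣ p ^ n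
¬2∣p^n p-prime p≢2 zero = from-no (2 ∣? 1)
¬2∣p^n {p} p-prime p≢2 (suc n) 2∣p*pⁿ with euclidsLemma p (p ^ n) prime[2] 2∣p*pⁿ
... | inj₂ 2∣pⁿ = ¬2∣p^n p-prime p≢2 n 2∣pⁿ
... | inj₁ 2∣p with prime⇒irreducible p-prime 2∣p
...   | inj₁ ()
...   | inj₂ 2≡p = p≢2 (≡.sym 2≡p)

module FieldProperties {q : ℕ} (F : FiniteField q) where

  open FiniteField F
  open Bijection enum using (injective; strictlySurjective) renaming (to to element)
  open import Algebra.Properties.Ring ring using (-‿involutive; +-inverseˡ-unique; +-cancelˡ; -‿distribˡ-*; -‿distribʳ-*; [y-z]x≈yx-zx; x∙y⁻¹≈ε⇒x≈y; x≈y⇒x∙y⁻¹≈ε)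
  open import Algebra.Properties.CommutativeSemigroup +-commutativeSemigroup using () renaming (interchange to +-interchange)
  open import Algebra.Properties.CommutativeSemigroup *-commutativeSemigroup using () renaming (interchange to *-interchange)
  open import Relation.Binary.Reasoning.Setoid setoid

  index : Carrier → Fin q
  index y = proj₁ (strictlySurjective y)

  element-index : ∀ y → element (index y) ≈ y
  element-index y = proj₂ (strictlySurjective y)

  index-cong : ∀ {x y} → x ≈ y → index x ≡ index y
  index-cong {x} {y} x≈y = injective (trans (element-index x) (trans x≈y (sym (element-index y))))

  index-injective : ∀ {x y} → index x ≡ index y → x ≈ y
  index-injective {x} {y} eq = trans (sym (element-index x)) (trans (reflexive (≡.cong element eq)) (element-index y))

  infix 4 _≟_
  _≟_ : Decidable _≈_
  x ≟ y = map′ index-injective index-cong (index x Fin.≟ index y)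

  _⁻¹ : ∀ {x} → ¬ x ≈ 0# → Carrier
  x≉0 ⁻¹ = proj₁ (inverse _ x≉0)

  *-inverseʳ : ∀ {x} (x≉0 : ¬ x ≈ 0#) → x * x≉0 ⁻¹ ≈ 1#
  *-inverseʳ x≉0 = proj₂ (inverse _ x≉0)

  *-cancelʳ : ∀ {x y z} → ¬ z ≈ 0# → x * z ≈ y * z → x ≈ y
  *-cancelʳ {x} {y} {z} z≉0 xz≈yz = begin
    x                    ≈⟨ *-identityʳ x ⟨
    x * 1#               ≈⟨ *-congˡ (*-inverseʳ z≉0) ⟨
    x * (z * z≉0 ⁻¹)     ≈⟨ *-assoc x z _ ⟨
    (x * z) * z≉0 ⁻¹     ≈⟨ *-congʳ xz≈yz ⟩
    (y * z) * z≉0 ⁻¹     ≈⟨ *-assoc y z _ ⟩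
    y * (z * z≉0 ⁻¹)     ≈⟨ *-congˡ (*-inverseʳ z≉0) ⟩
    y * 1#               ≈⟨ *-identityʳ y ⟩
    y                    ∎

  *-cancelˡ : ∀ {x y z} → ¬ z ≈ 0# → z * x ≈ z * y → x ≈ y
  *-cancelˡ {x} {y} {z} z≉0 zx≈zy = *-cancelʳ z≉0 (trans (*-comm x z) (trans zx≈zy (*-comm z y)))

  x*y≈0⇒x≈0∨y≈0 : ∀ {x y} → x * y ≈ 0# → x ≈ 0# ⊎ y ≈ 0#
  x*y≈0⇒x≈0∨y≈0 {x} {y} xy≈0 with x ≟ 0#
  ... | yes x≈0 = inj₁ x≈0
  ... | no x≉0 = inj₂ (*-cancelˡ x≉0 (trans xy≈0 (sym (zeroʳ x))))

  z*x≈z*y⇒z≈0∨x≈y : ∀ {x y z} → z * x ≈ z * y → z ≈ 0# ⊎ x ≈ y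
  z*x≈z*y⇒z≈0∨x≈y {z = z} zx≈zy with z ≟ 0#
  ... | yes z≈0 = inj₁ z≈0
  ... | no z≉0 = inj₂ (*-cancelˡ z≉0 zx≈zy)

  [a-b]+[b-c]≈a-c : ∀ a b c → (a - b) + (b - c) ≈ a - c
  [a-b]+[b-c]≈a-c a b c = begin
    (a - b) + (b - c)    ≈⟨ +-assoc a (- b) (b - c) ⟩
    a + (- b + (b - c))  ≈⟨ +-congˡ (+-assoc (- b) b (- c)) ⟨
    a + ((- b + b) - c)  ≈⟨ +-congˡ (+-congʳ (-‿inverseˡ b)) ⟩
    a + (0# - c)         ≈⟨ +-congˡ (+-identityˡ (- c)) ⟩
    a - c                ∎

  x+y≈z+w⇒x-z≈w-y : ∀ {x y z w} → x + y ≈ z + w → x - z ≈ w - y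
  x+y≈z+w⇒x-z≈w-y {x} {y} {z} {w} eq = begin
    x - z                  ≈⟨ +-identityʳ (x - z) ⟨
    (x - z) + 0#           ≈⟨ +-congˡ (-‿inverseʳ y) ⟨
    (x - z) + (y - y)      ≈⟨ +-interchange x (- z) y (- y) ⟩
    (x + y) + (- z - y)    ≈⟨ +-congʳ eq ⟩
    (z + w) + (- z - y)    ≈⟨ +-interchange z w (- z) (- y) ⟩
    (z - z) + (w - y)      ≈⟨ +-congʳ (-‿inverseʳ z) ⟩
    0# + (w - y)           ≈⟨ +-identityˡ (w - y) ⟩
    w - y                  ∎

  [x-y][x+y]≈x²-y² : ∀ x y → (x - y) * (x + y) ≈ x * x - y * y
  [x-y][x+y]≈x²-y² x y = begin
    (x - y) * (x + y)                  ≈⟨ distribˡ (x - y) x y ⟩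
    (x - y) * x + (x - y) * y          ≈⟨ +-cong ([y-z]x≈yx-zx x x y) ([y-z]x≈yx-zx y x y) ⟩
    (x * x - y * x) + (x * y - y * y)  ≈⟨ +-congʳ (+-congˡ (-‿cong (*-comm y x))) ⟩
    (x * x - x * y) + (x * y - y * y)  ≈⟨ [a-b]+[b-c]≈a-c (x * x) (x * y) (y * y) ⟩
    x * x - y * y                      ∎

  x*x≈y*y⇒x≈±y : ∀ {x y} → x * x ≈ y * y → x ≈ y ⊎ x ≈ - y
  x*x≈y*y⇒x≈±y {x} {y} xx≈yy with x*y≈0⇒x≈0∨y≈0 (trans ([x-y][x+y]≈x²-y² x y) (x≈y⇒x∙y⁻¹≈ε xx≈yy))
  ... | inj₁ x-y≈0 = inj₁ (x∙y⁻¹≈ε⇒x≈y x y x-y≈0)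
  ... | inj₂ x+y≈0 = inj₂ (+-inverseˡ-unique x y x+y≈0)

  -x*-x≈x*x : ∀ x → - x * - x ≈ x * x
  -x*-x≈x*x x = begin
    - x * - x    ≈⟨ -‿distribˡ-* x (- x) ⟨
    - (x * - x)  ≈⟨ -‿cong (-‿distribʳ-* x x) ⟨
    - - (x * x)  ≈⟨ -‿involutive (x * x) ⟩
    x * x        ∎

  x+x≈0⇒x≈0 : ¬ 1# + 1# ≈ 0# → ∀ {x} → x + x ≈ 0# → x ≈ 0#
  x+x≈0⇒x≈0 2≉0 {x} x+x≈0 with x*y≈0⇒x≈0∨y≈0 {1# + 1#} {x} (trans (distribʳ x 1# 1#) (trans (+-cong (*-identityˡ x) (*-identityˡ x)) x+x≈0))
  ... | inj₁ 2≈0 = contradiction 2≈0 2≉0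
  ... | inj₂ x≈0 = x≈0

  x≈-x⇒x≈0 : ¬ 1# + 1# ≈ 0# → ∀ {x} → x ≈ - x → x ≈ 0#
  x≈-x⇒x≈0 2≉0 {x} x≈-x = x+x≈0⇒x≈0 2≉0 (trans (+-congˡ x≈-x) (-‿inverseʳ x))

  IsSquare-ratio : ∀ {c r s} → ¬ s ≈ 0# → r * r ≈ c * (s * s) → Graph.IsSquare F c
  IsSquare-ratio {c} {r} {s} s≉0 rr≈css = r * s⁻¹ , (begin
    (r * s⁻¹) * (r * s⁻¹)        ≈⟨ *-interchange r s⁻¹ r s⁻¹ ⟩
    (r * r) * (s⁻¹ * s⁻¹)        ≈⟨ *-congʳ rr≈css ⟩
    (c * (s * s)) * (s⁻¹ * s⁻¹)  ≈⟨ *-assoc c (s * s) (s⁻¹ * s⁻¹) ⟩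
    c * ((s * s) * (s⁻¹ * s⁻¹))  ≈⟨ *-congˡ (*-interchange s s s⁻¹ s⁻¹) ⟩
    c * ((s * s⁻¹) * (s * s⁻¹))  ≈⟨ *-congˡ (*-cong (*-inverseʳ s≉0) (*-inverseʳ s≉0)) ⟩
    c * (1# * 1#)                ≈⟨ *-congˡ (*-identityˡ 1#) ⟩
    c * 1#                       ≈⟨ *-identityʳ c ⟩
    c                            ∎)
    where
    s⁻¹ : Carrier
    s⁻¹ = s≉0 ⁻¹

  cube : Carrier → Carrier
  cube x = x * x * x

  cube-cong : ∀ {x y} → x ≈ y → cube x ≈ cube y
  cube-cong x≈y = *-cong (*-cong x≈y x≈y) x≈y

  cube-* : ∀ x y → cube (x * y) ≈ cube x * cube y
  cube-* x y = begin
    ((x * y) * (x * y)) * (x * y)  ≈⟨ *-congʳ (*-interchange x y x y) ⟩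
    ((x * x) * (y * y)) * (x * y)  ≈⟨ *-interchange (x * x) (y * y) x y ⟩
    cube x * cube y                ∎

  cube-neg : ∀ x → cube (- x) ≈ - cube x
  cube-neg x = trans (*-congʳ (-x*-x≈x*x x)) (sym (-‿distribʳ-* (x * x) x))

  cube≈0⇒x≈0 : ∀ {x} → cube x ≈ 0# → x ≈ 0#
  cube≈0⇒x≈0 x³≈0 with x*y≈0⇒x≈0∨y≈0 x³≈0
  ... | inj₂ x≈0 = x≈0
  ... | inj₁ x²≈0 with x*y≈0⇒x≈0∨y≈0 x²≈0
  ...   | inj₁ x≈0 = x≈0
  ...   | inj₂ x≈0 = x≈0

  module OrbitCounting (g : Carrier → Carrier) (g-cong : ∀ {x y} → x ≈ y → g x ≈ g y) where

    ĝ : Fin q → Fin q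
    ĝ i = index (g (element i))

    element-fold : ∀ j i → element (fold i ĝ j) ≈ fold (element i) g j
    element-fold zero i = refl
    element-fold (suc j) i = trans (element-index _) (g-cong (element-fold j i))

    m∣#positions : ∀ m .{{_ : NonZero m}} {xs : List (Fin q)} → Unique xs
      → (∀ {i} → i ∈ xs → ĝ i ∈ xs)
      → (∀ {i} → i ∈ xs → fold (element i) g m ≈ element i)
      → (∀ {i j} → i ∈ xs → 0 < j → j < m → ¬ fold (element i) g j ≈ element i)
      → m ∣ length xs
    m∣#positions m xs! closed periodic aperiodic = m∣length xs! (record
      { closed    = closed
      ; periodic  = λ i∈xs → injective (trans (element-fold m _) (periodic i∈xs))
      ; aperiodic = λ {i} {j} i∈xs 0<j j<m eq →
          aperiodic i∈xs 0<j j<m (trans (sym (element-fold j i)) (reflexive (≡.cong element eq)))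
      })
      where open Counting.FreeAction Fin._≟_ ĝ m

  #allFin : length (allFin q) ≡ q
  #allFin = length-tabulate (λ i → i)

  1+1≈0⇒2∣q : 1# + 1# ≈ 0# → 2 ∣ q
  1+1≈0⇒2∣q 2≈0 = ≡.subst (2 ∣_) #allFin
    (m∣#positions 2 (allFin⁺ q) (λ _ → ∈-allFin _) (λ _ → x+1+1≈x) x+1≉x)
    where
    open OrbitCounting (_+ 1#) +-congʳ
    x+1+1≈x : ∀ {x} → (x + 1#) + 1# ≈ x
    x+1+1≈x {x} = trans (+-assoc x 1# 1#) (trans (+-congˡ 2≈0) (+-identityʳ x))
    x+1≉x : ∀ {i j} → i ∈ allFin q → 0 < j → j < 2 → ¬ fold (element i) (_+ 1#) j ≈ element i
    x+1≉x {i} {suc zero} _ _ _ x+1≈x = 0≉1 (sym (+-cancelˡ (element i) 1# 0# (trans x+1≈x (sym (+-identityʳ _)))))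
    x+1≉x {j = suc (suc _)} _ _ (s≤s (s≤s ()))

  x*y≉0 : ∀ {x y} → ¬ x ≈ 0# → ¬ y ≈ 0# → ¬ x * y ≈ 0#
  x*y≉0 x≉0 y≉0 xy≈0 with x*y≈0⇒x≈0∨y≈0 xy≈0
  ... | inj₁ x≈0 = x≉0 x≈0
  ... | inj₂ y≈0 = y≉0 y≈0

  cube≈1⇒3∣q∸1 : ∀ {ω} → cube ω ≈ 1# → ¬ ω ≈ 1# → 3 ∣ q ∸ 1
  cube≈1⇒3∣q∸1 {ω} ω³≈1 ω≉1 = ≡.subst (3 ∣_) #nonzero≡q∸1
    (m∣#positions 3 (∖-unique [ index 0# ] (allFin⁺ q)) closed (λ _ → ω³x≈x) ωx≉x)
    where
    open OrbitCounting (ω *_) *-congˡ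
    open Counting Fin._≟_ using (_∖_; ∈-∖⁻; ∈-∖⁺; ∖-unique; length-∖)

    nonzero : List (Fin q)
    nonzero = allFin q ∖ [ index 0# ]

    #nonzero≡q∸1 : length nonzero ≡ q ∸ 1
    #nonzero≡q∸1 = ≡.sym (≡.cong (_∸ 1) (≡.trans (≡.sym #allFin)
      (length-∖ {ys = [ index 0# ]} (allFin⁺ q) (All.[] ∷ []) (λ { (here ≡.refl) → ∈-allFin _ }))))

    nonzero-≉0 : ∀ {i} → i ∈ nonzero → ¬ element i ≈ 0#
    nonzero-≉0 i∈ x≈0 = proj₂ (∈-∖⁻ (allFin q) _ i∈) (here (injective (trans x≈0 (sym (element-index 0#)))))

    ω≉0 : ¬ ω ≈ 0#
    ω≉0 ω≈0 = 0≉1 (trans (sym (trans (cube-cong ω≈0) (zeroʳ _))) ω³≈1)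

    closed : ∀ {i} → i ∈ nonzero → ĝ i ∈ nonzero
    closed i∈ = ∈-∖⁺ [ index 0# ] (∈-allFin _) λ { (here ĝi≡0) →
      x*y≉0 ω≉0 (nonzero-≉0 i∈) (index-injective ĝi≡0) }

    ω³x≈x : ∀ {x} → ω * (ω * (ω * x)) ≈ x
    ω³x≈x {x} = begin
      ω * (ω * (ω * x))  ≈⟨ *-assoc ω ω (ω * x) ⟨
      (ω * ω) * (ω * x)  ≈⟨ *-assoc (ω * ω) ω x ⟨
      cube ω * x         ≈⟨ *-congʳ ω³≈1 ⟩
      1# * x             ≈⟨ *-identityˡ x ⟩
      x                  ∎

    ωx≉x : ∀ {i j} → i ∈ nonzero → 0 < j → j < 3 → ¬ fold (element i) (ω *_) j ≈ element i
    ωx≉x {i} {suc zero} i∈ _ _ ωx≈x = ω≉1 (*-cancelʳ (nonzero-≉0 i∈) (trans ωx≈x (sym (*-identityˡ _))))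
    ωx≉x {i} {suc (suc zero)} i∈ _ _ ω²x≈x = ωx≉x {j = 1} i∈ (s≤s z≤n) (s≤s (s≤s z≤n)) (sym (trans (sym ω³x≈x) (*-congˡ ω²x≈x)))
    ωx≉x {j = suc (suc (suc _))} _ _ (s≤s (s≤s (s≤s ())))

  module CubeBijection (3∤q∸1 : ¬ 3 ∣ q ∸ 1) where

    cube≈1⇒x≈1 : ∀ {ω} → cube ω ≈ 1# → ω ≈ 1#
    cube≈1⇒x≈1 {ω} ω³≈1 with ω ≟ 1#
    ... | yes ω≈1 = ω≈1
    ... | no ω≉1 = contradiction (cube≈1⇒3∣q∸1 ω³≈1 ω≉1) 3∤q∸1

    cube-injective : ∀ {x y} → cube x ≈ cube y → x ≈ y
    cube-injective {x} {y} x³≈y³ with y ≟ 0#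
    ... | yes y≈0 = trans (cube≈0⇒x≈0 (trans x³≈y³ (trans (cube-cong y≈0) (zeroʳ _)))) (sym y≈0)
    ... | no y≉0 = *-cancelʳ y⁻¹≉0 (trans (cube≈1⇒x≈1 x/y³≈1) (sym (*-inverseʳ y≉0)))
      where
      y⁻¹ : Carrier
      y⁻¹ = y≉0 ⁻¹
      y⁻¹≉0 : ¬ y⁻¹ ≈ 0#
      y⁻¹≉0 y⁻¹≈0 = 0≉1 (trans (sym (trans (*-congˡ y⁻¹≈0) (zeroʳ y))) (*-inverseʳ y≉0))
      x/y³≈1 : cube (x * y⁻¹) ≈ 1#
      x/y³≈1 = begin
        cube (x * y⁻¹)      ≈⟨ cube-* x y⁻¹ ⟩
        cube x * cube y⁻¹   ≈⟨ *-congʳ x³≈y³ ⟩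
        cube y * cube y⁻¹   ≈⟨ cube-* y y⁻¹ ⟨
        cube (y * y⁻¹)      ≈⟨ cube-cong (*-inverseʳ y≉0) ⟩
        cube 1#             ≈⟨ trans (*-identityʳ _) (*-identityʳ _) ⟩
        1#                  ∎

    cube-index : Fin q → Fin q
    cube-index i = index (cube (element i))

    cube-index-injective : ∀ {i j} → cube-index i ≡ cube-index j → i ≡ j
    cube-index-injective ci≡cj = injective (cube-injective (index-injective ci≡cj))

    cube-surjective : ∀ y → ∃ λ x → cube x ≈ y
    cube-surjective y with i , ci≡y ← injective⇒surjective cube-index cube-index-injective (index y) =
      element i , index-injective ci≡y

module GraphProperties {q : ℕ} (F : FiniteField q) (lam : FiniteField.Carrier F)
  (f : FiniteField.Carrier F → FiniteField.Carrier F) where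

  open FiniteField F
  open Graph F
  open FieldProperties F using (-x*-x≈x*x)
  open import Algebra.Properties.Ring ring using (x≈y⇒x∙y⁻¹≈ε)

  Edge-square : ∀ {t w} → f t ≈ w * w → Edge lam f t w
  Edge-square ft≈w² = trans (*-congʳ (x≈y⇒x∙y⁻¹≈ε (sym ft≈w²))) (zeroˡ _)

  Edge-λsquare : ∀ {t w} → f t ≈ lam * (w * w) → Edge lam f t w
  Edge-λsquare ft≈λw² = trans (*-congˡ (x≈y⇒x∙y⁻¹≈ε (sym ft≈λw²))) (zeroʳ _)

  Edge-resp-square : ∀ {t w z} → w * w ≈ z * z → Edge lam f t w → Edge lam f t z
  Edge-resp-square w²≈z² = trans (*-cong (+-congʳ (sym w²≈z²)) (+-congʳ (*-congˡ (sym w²≈z²))))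

  Conn-neg : (∀ w → ∃ λ t → f t ≈ w * w) → ∀ {x w} → Conn lam f x w → Conn lam f x (- w)
  Conn-neg squares-are-values {w = w} x~w with t , ft≈w² ← squares-are-values w =
    x~w ◅◅ inj₂ (inj₁ (Edge-square ft≈w²)) ◅ inj₁ (Edge-resp-square (sym (-x*-x≈x*x w)) (Edge-square ft≈w²)) ◅ ε

module NoFourVertexComponent {q : ℕ} (F : FiniteField q) where

  open FiniteField F
  open FieldProperties F
  open Graph F
  open import Algebra.Properties.Ring ring using (-‿involutive; -0#≈0#; //-rightDividesˡ; [y-z]x≈yx-zx; x∙y⁻¹≈ε⇒x≈y)
  open import Algebra.Properties.CommutativeSemigroup +-commutativeSemigroup using () renaming (interchange to +-interchange)
  open import Relation.Binary.Reasoning.Setoid setoid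

  module _ (2≉0 : ¬ 1# + 1# ≈ 0#) (cube-surjective : ∀ y → ∃ λ x → cube x ≈ y)
    (lam a : Carrier) (lam-nonsquare : ¬ IsSquare lam) (a≉0 : ¬ a ≈ 0#) where

    open GraphProperties F lam (cubePlus a)

    f : Carrier → Carrier
    f = cubePlus a

    f-cong : ∀ {x y} → x ≈ y → f x ≈ f y
    f-cong x≈y = +-congʳ (cube-cong x≈y)

    f-surjective : ∀ y → ∃ λ t → f t ≈ y
    f-surjective y with t , t³≈y-a ← cube-surjective (y - a) = t , trans (+-congʳ t³≈y-a) (//-rightDividesˡ a y)

    f[x]+f[-x]≈a+a : ∀ x → f x + f (- x) ≈ a + a
    f[x]+f[-x]≈a+a x = begin
      (cube x + a) + (cube (- x) + a)  ≈⟨ +-congˡ (+-congʳ (cube-neg x)) ⟩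
      (cube x + a) + (- cube x + a)    ≈⟨ +-interchange (cube x) a (- cube x) a ⟩
      (cube x - cube x) + (a + a)      ≈⟨ +-congʳ (-‿inverseʳ (cube x)) ⟩
      0# + (a + a)                     ≈⟨ +-identityˡ (a + a) ⟩
      a + a                            ∎

    a+a≉0 : ¬ a + a ≈ 0#
    a+a≉0 a+a≈0 = a≉0 (x+x≈0⇒x≈0 2≉0 a+a≈0)

    lam≉0 : ¬ lam ≈ 0#
    lam≉0 lam≈0 = lam-nonsquare (0# , trans (zeroˡ 0#) (sym lam≈0))

    lam≉1 : ¬ lam ≈ 1#
    lam≉1 lam≈1 = lam-nonsquare (1# , trans (*-identityˡ 1#) (sym lam≈1))

    r²≉λs² : ∀ {r s} → ¬ s ≈ 0# → ¬ r * r ≈ lam * (s * s)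
    r²≉λs² s≉0 r²≈λs² = lam-nonsquare (IsSquare-ratio s≉0 r²≈λs²)

    [1+λ]x≈x+λx : ∀ x → (1# + lam) * x ≈ x + lam * x
    [1+λ]x≈x+λx x = trans (distribʳ x 1# lam) (+-congʳ (*-identityˡ x))

    [1-λ]x≈x-λx : ∀ x → (1# - lam) * x ≈ x - lam * x
    [1-λ]x≈x-λx x = trans ([y-z]x≈yx-zx x 1# lam) (+-congʳ (*-identityˡ x))

    module _ {U W : Carrier} (U≉W : ¬ U ≈ W) where

      ¬[U+λU][W+λW] : U + lam * U ≈ a + a → W + lam * W ≈ a + a → ⊥
      ¬[U+λU][W+λW] U+λU≈2a W+λW≈2a with z*x≈z*y⇒z≈0∨x≈y (trans ([1+λ]x≈x+λx U) (trans U+λU≈2a (trans (sym W+λW≈2a) (sym ([1+λ]x≈x+λx W)))))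
      ... | inj₁ 1+λ≈0 = a+a≉0 (trans (sym U+λU≈2a) (trans (sym ([1+λ]x≈x+λx U)) (trans (*-congʳ 1+λ≈0) (zeroˡ U))))
      ... | inj₂ U≈W = U≉W U≈W

      ¬[U+W][λU+λW] : U + W ≈ a + a → lam * U + lam * W ≈ a + a → ⊥
      ¬[U+W][λU+λW] U+W≈2a λU+λW≈2a = lam≉1 (*-cancelʳ U+W≉0 (begin
        lam * (U + W)          ≈⟨ distribˡ lam U W ⟩
        lam * U + lam * W      ≈⟨ λU+λW≈2a ⟩
        a + a                  ≈⟨ U+W≈2a ⟨
        U + W                  ≈⟨ *-identityˡ (U + W) ⟨
        1# * (U + W)           ∎))
        where
        U+W≉0 : ¬ U + W ≈ 0#
        U+W≉0 U+W≈0 = a+a≉0 (trans (sym U+W≈2a) U+W≈0)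

      ¬[U+λW][λU+W] : U + lam * W ≈ a + a → lam * U + W ≈ a + a → ⊥
      ¬[U+λW][λU+W] U+λW≈2a λU+W≈2a with z*x≈z*y⇒z≈0∨x≈y (begin
        (1# - lam) * U   ≈⟨ [1-λ]x≈x-λx U ⟩
        U - lam * U      ≈⟨ x+y≈z+w⇒x-z≈w-y (trans U+λW≈2a (sym λU+W≈2a)) ⟩
        W - lam * W      ≈⟨ [1-λ]x≈x-λx W ⟨
        (1# - lam) * W   ∎)
      ... | inj₁ 1-λ≈0 = lam≉1 (sym (x∙y⁻¹≈ε⇒x≈y 1# lam 1-λ≈0))
      ... | inj₂ U≈W = U≉W U≈W

    module Component (x₀ : Carrier) (v : Fin 4 → Carrier) (v-injective : ∀ i j → v i ≈ v j → i ≡ j)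
      (members : ∀ y → (Conn lam f x₀ y → ∃ λ i → y ≈ v i) × ((∃ λ i → y ≈ v i) → Conn lam f x₀ y)) where

      C : Carrier → Set
      C = Conn lam f x₀

      position : ∀ {y} → C y → Fin 4
      position {y} y∈C = proj₁ (proj₁ (members y) y∈C)

      ≈v-position : ∀ {y} (y∈C : C y) → y ≈ v (position y∈C)
      ≈v-position {y} y∈C = proj₂ (proj₁ (members y) y∈C)

      v∈C : ∀ i → C (v i)
      v∈C i = proj₂ (members (v i)) (i , refl)

      source∈C : ∀ {t w} → Edge lam f t w → C w → C t
      source∈C t→w w∈C = w∈C ◅◅ inj₂ (inj₁ t→w) ◅ ε

      neg∈C : ∀ {w} → C w → C (- w)
      neg∈C = Conn-neg (λ w → f-surjective (w * w))

      ν : Fin 4 → Fin 4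
      ν i = position (neg∈C (v∈C i))

      v∘ν≈-v : ∀ i → v (ν i) ≈ - v i
      v∘ν≈-v i = sym (≈v-position (neg∈C (v∈C i)))

      ν-involutive : ∀ i → ν (ν i) ≡ i
      ν-involutive i = v-injective _ _ (trans (v∘ν≈-v (ν i)) (trans (-‿cong (v∘ν≈-v i)) (-‿involutive (v i))))

      ν-fixed⇒v≈0 : ∀ {i} → ν i ≡ i → v i ≈ 0#
      ν-fixed⇒v≈0 {i} νi≡i = x≈-x⇒x≈0 2≉0 (trans (reflexive (≡.cong v (≡.sym νi≡i))) (v∘ν≈-v i))

      v≉0 : ∀ i → ¬ v i ≈ 0#
      v≉0 i₀ vi₀≈0 = from-no (2 ∣? 3) (≡.subst (2 ∣_) #others≡3
        (2∣length-involution ν ν-involutive (∖-unique [ i₀ ] (allFin⁺ 4)) closed fixedPointFree))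
        where
        open Counting Fin._≟_
        others : List (Fin 4)
        others = allFin 4 ∖ [ i₀ ]
        #others≡3 : length others ≡ 3
        #others≡3 = ≡.cong (_∸ 1) (≡.sym (length-∖ {ys = [ i₀ ]} (allFin⁺ 4) (All.[] ∷ []) (λ { (here ≡.refl) → ∈-allFin i₀ })))
        ≢i₀ : ∀ {j} → j ∈ others → j ≢ i₀
        ≢i₀ j∈ j≡i₀ = proj₂ (∈-∖⁻ (allFin 4) [ i₀ ] j∈) (here j≡i₀)
        νi₀≡i₀ : ν i₀ ≡ i₀
        νi₀≡i₀ = v-injective _ _ (trans (v∘ν≈-v i₀) (trans (-‿cong vi₀≈0) (trans -0#≈0# (sym vi₀≈0))))
        closed : ∀ {j} → j ∈ others → ν j ∈ others
        closed j∈ = ∈-∖⁺ [ i₀ ] (∈-allFin _) λ { (here νj≡i₀) →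
          ≢i₀ j∈ (≡.trans (≡.sym (involution-flip ν ν-involutive νj≡i₀)) νi₀≡i₀) }
        fixedPointFree : ∀ {j} → j ∈ others → ν j ≢ j
        fixedPointFree j∈ νj≡j = ≢i₀ j∈ (v-injective _ _ (trans (ν-fixed⇒v≈0 νj≡j) (sym vi₀≈0)))

      u : Carrier
      u = v 0F

      another-square : ∃ λ k → ¬ v k * v k ≈ u * u
      another-square with v 1F * v 1F ≟ u * u | v 2F * v 2F ≟ u * u
      ... | no v₁²≉u² | _ = 1F , v₁²≉u²
      ... | yes _ | no v₂²≉u² = 2F , v₂²≉u²
      ... | yes v₁²≈u² | yes v₂²≈u² with x*x≈y*y⇒x≈±y v₁²≈u² | x*x≈y*y⇒x≈±y v₂²≈u²
      ...   | inj₁ v₁≈u | _ = contradiction (v-injective 1F 0F v₁≈u) λ ()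
      ...   | _ | inj₁ v₂≈u = contradiction (v-injective 2F 0F v₂≈u) λ ()
      ...   | inj₂ v₁≈-u | inj₂ v₂≈-u = contradiction (v-injective 1F 2F (trans v₁≈-u (sym v₂≈-u))) λ ()

      w : Carrier
      w = v (proj₁ another-square)

      U W : Carrier
      U = u * u
      W = w * w

      U≉W : ¬ U ≈ W
      U≉W U≈W = proj₂ another-square (sym U≈W)

      base : Fin 4 → Fin 4
      base 0F = 0F
      base 1F = 0F
      base 2F = proj₁ another-square
      base 3F = proj₁ another-square

      c : Fin 4 → Carrier
      c 0F = U
      c 1F = lam * U
      c 2F = W
      c 3F = lam * W

      c-injective : ∀ k l → c k ≈ c l → k ≡ l
      c-injective 0F 0F _ = ≡.refl
      c-injective 0F 1F U≈λU = contradiction U≈λU (r²≉λs² (v≉0 0F))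
      c-injective 0F 2F U≈W = contradiction U≈W U≉W
      c-injective 0F 3F U≈λW = contradiction U≈λW (r²≉λs² (v≉0 _))
      c-injective 1F 0F λU≈U = contradiction (sym λU≈U) (r²≉λs² (v≉0 0F))
      c-injective 1F 1F _ = ≡.refl
      c-injective 1F 2F λU≈W = contradiction (sym λU≈W) (r²≉λs² (v≉0 0F))
      c-injective 1F 3F λU≈λW = contradiction (*-cancelˡ lam≉0 λU≈λW) U≉W
      c-injective 2F 0F W≈U = contradiction (sym W≈U) U≉W
      c-injective 2F 1F W≈λU = contradiction W≈λU (r²≉λs² (v≉0 0F))
      c-injective 2F 2F _ = ≡.refl
      c-injective 2F 3F W≈λW = contradiction W≈λW (r²≉λs² (v≉0 _))
      c-injective 3F 0F λW≈U = contradiction (sym λW≈U) (r²≉λs² (v≉0 _))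
      c-injective 3F 1F λW≈λU = contradiction (*-cancelˡ lam≉0 (sym λW≈λU)) U≉W
      c-injective 3F 2F λW≈W = contradiction (sym λW≈W) (r²≉λs² (v≉0 _))
      c-injective 3F 3F _ = ≡.refl

      T : Fin 4 → Carrier
      T k = proj₁ (f-surjective (c k))

      f∘T≈c : ∀ k → f (T k) ≈ c k
      f∘T≈c k = proj₂ (f-surjective (c k))

      T→base : ∀ k → Edge lam f (T k) (v (base k))
      T→base 0F = Edge-square (f∘T≈c 0F)
      T→base 1F = Edge-λsquare (f∘T≈c 1F)
      T→base 2F = Edge-square (f∘T≈c 2F)
      T→base 3F = Edge-λsquare (f∘T≈c 3F)

      T∈C : ∀ k → C (T k)
      T∈C k = source∈C (T→base k) (v∈C (base k))

      τ : Fin 4 → Fin 4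
      τ k = position (T∈C k)

      T≈v∘τ : ∀ k → T k ≈ v (τ k)
      T≈v∘τ k = ≈v-position (T∈C k)

      T-injective : ∀ {k l} → T k ≈ T l → k ≡ l
      T-injective {k} {l} Tk≈Tl = c-injective k l (trans (sym (f∘T≈c k)) (trans (f-cong Tk≈Tl) (f∘T≈c l)))

      τ-injective : ∀ {k l} → τ k ≡ τ l → k ≡ l
      τ-injective {k} {l} τk≡τl = T-injective (trans (T≈v∘τ k) (trans (reflexive (≡.cong v τk≡τl)) (sym (T≈v∘τ l))))

      partner : ∀ k → ∃ λ l → T l ≈ - T k
      partner k = proj₁ preimage ,
        trans (T≈v∘τ (proj₁ preimage)) (trans (reflexive (≡.cong v (proj₂ preimage))) (sym (≈v-position -Tk∈C)))
        where
        -Tk∈C : C (- T k)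
        -Tk∈C = neg∈C (T∈C k)
        preimage : ∃ λ l → τ l ≡ position -Tk∈C
        preimage = injective⇒surjective τ τ-injective (position -Tk∈C)

      ρ : Fin 4 → Fin 4
      ρ k = proj₁ (partner k)

      T∘ρ≈-T : ∀ k → T (ρ k) ≈ - T k
      T∘ρ≈-T k = proj₂ (partner k)

      ρ-involutive : ∀ k → ρ (ρ k) ≡ k
      ρ-involutive k = T-injective (trans (T∘ρ≈-T (ρ k)) (trans (-‿cong (T∘ρ≈-T k)) (-‿involutive (T k))))

      ρ-fixedPointFree : ∀ k → ρ k ≢ k
      ρ-fixedPointFree k ρk≡k = v≉0 (τ k) (trans (sym (T≈v∘τ k)) (x≈-x⇒x≈0 2≉0 Tk≈-Tk))
        where
        Tk≈-Tk : T k ≈ - T k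
        Tk≈-Tk = trans (reflexive (≡.cong T (≡.sym ρk≡k))) (T∘ρ≈-T k)

      c+c∘ρ≈a+a : ∀ k {l} → ρ k ≡ l → c k + c l ≈ a + a
      c+c∘ρ≈a+a k ≡.refl = begin
        c k + c (ρ k)          ≈⟨ +-cong (f∘T≈c k) (f∘T≈c (ρ k)) ⟨
        f (T k) + f (T (ρ k))  ≈⟨ +-congˡ (f-cong (T∘ρ≈-T k)) ⟩
        f (T k) + f (- T k)    ≈⟨ f[x]+f[-x]≈a+a (T k) ⟩
        a + a                  ∎

      impossible : ⊥
      impossible = every-matching-impossible (fixedPointFreeInvolution-Fin4 ρ ρ-involutive ρ-fixedPointFree)
        where
        every-matching-impossible : (ρ 0F ≡ 1F × ρ 2F ≡ 3F) ⊎ (ρ 0F ≡ 2F × ρ 1F ≡ 3F) ⊎ (ρ 0F ≡ 3F × ρ 1F ≡ 2F) → ⊥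
        every-matching-impossible (inj₁ (ρ0≡1 , ρ2≡3))        = ¬[U+λU][W+λW] U≉W (c+c∘ρ≈a+a 0F ρ0≡1) (c+c∘ρ≈a+a 2F ρ2≡3)
        every-matching-impossible (inj₂ (inj₁ (ρ0≡2 , ρ1≡3))) = ¬[U+W][λU+λW] U≉W (c+c∘ρ≈a+a 0F ρ0≡2) (c+c∘ρ≈a+a 1F ρ1≡3)
        every-matching-impossible (inj₂ (inj₂ (ρ0≡3 , ρ1≡2))) = ¬[U+λW][λU+W] U≉W (c+c∘ρ≈a+a 0F ρ0≡3) (c+c∘ρ≈a+a 1F ρ1≡2)

    no-component-of-size-4 : ¬ HasComponentOfSize lam f 4
    no-component-of-size-4 (x₀ , v , v-injective , members) = Component.impossible x₀ v v-injective members

proposition6p6 : (p k q : ℕ) → Prime p → ¬ (p ≡ 2) → q ≡ p ^ suc k → ¬ (3 ∣ q ∸ 1) →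
    (F : FiniteField q) → (lam a : FiniteField.Carrier F) →
    ¬ Graph.IsSquare F lam → ¬ FiniteField._≈_ F a (FiniteField.0# F) →
    ¬ Graph.HasComponentOfSize F lam (Graph.cubePlus F a) 4
proposition6p6 p k q p-prime p≢2 q≡p^[k+1] 3∤q∸1 F lam a lam-nonsquare a≉0 =
  NoFourVertexComponent.no-component-of-size-4 F 2≉0 cube-surjective lam a lam-nonsquare a≉0
  where
  open FiniteField F using (_≈_; _+_; 0#; 1#)
  open FieldProperties F using (1+1≈0⇒2∣q; module CubeBijection)
  open CubeBijection 3∤q∸1 using (cube-surjective)
  2≉0 : ¬ 1# + 1# ≈ 0#
  2≉0 2≈0 = ¬2∣p^n p-prime p≢2 (suc k) (≡.subst (2 ∣_) q≡p^[k+1] (1+1≈0⇒2∣q 2≈0))
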